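{- Fix $a\in\mathbb{R}\setminus\{0\}$. For every $m\in\mathbb{N}_{\ge1}$, $d\in\mathbb{N}$, $M\in\mathbb{N}_{\ge1}$ and integer $l$ with $0\le l\le q_1(M)$, $$\alpha^{(d,m)}_{M+2^l}=\alpha^{(d,m)}_M+\alpha^{(d,m)}_{2^l}+\sum_{p=0}^{m-1}\binom{m}{p}M^{m-p}\gamma^{(d,p,m)}_l+2^lS^{(d,m)}_M.$$
   Context: For $k\in\mathbb{N}_{\ge1}$ write $k=\sum_{j=1}^{s_k}2^{q_j(k)}$ with $0\le q_1(k)<\cdots<q_{s_k}(k)$ (binary decomposition); $M_i(k)=\sum_{j=i}^{s_k}2^{q_j(k)}$ for $1\le i\le s_k+1$ (so $M_{s_k+1}(k)=0$). Convention $0^0=1$. For $d,m\in\mathbb{N}$, $n\ge1$: $S^{(d,m)}_n=\sum_{j=1}^{s_n-1}q_j(n)^d(2^{ -m}a)^{q_j(n)}M_{j+1}(n)^m$ and $\alpha^{(d,m)}_n=\sum_{k=1}^{n-1}S^{(d,m)}_k$. For $l,p\in\mathbb{N}$ with $p<m$: $\gamma^{(d,p,m)}_l=\sum_{k=1}^{2^l-1}\sum_{i=1}^{s_k}q_i(k)^d(2^{ -m}a)^{q_i(k)}M_{i+1}(k)^p$. -}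

module Defs where

open import Level using (Level)
open import Data.Nat as ℕ using (ℕ; zero; suc; _∸_)
open import Data.Nat.DivMod using (_/_; _%_)
open import Data.List using (List; []; _∷_; length; drop; map)
open import Data.Nat.ListAction using (sum)
open import Data.Bool using (if_then_else_)
open import Algebra.Bundles using (CommutativeRing)

-- Binary decomposition: list of exponents q₁ < q₂ < ... < q_s (increasing).
bitsGo : ℕ → ℕ → ℕ → List ℕ
bitsGo zero    n o = []
bitsGo (suc f) zero o = []
bitsGo (suc f) n@(suc _) o =
  if n % 2 ℕ.≡ᵇ 1 then o ∷ bitsGo f (n / 2) (suc o) else bitsGo f (n / 2) (suc o)

bits : ℕ → List ℕ
bits n = bitsGo n n 0

s : ℕ → ℕ
s k = length (bits k)

nth : List ℕ → ℕ → ℕ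
nth []       _       = 0
nth (x ∷ xs) zero    = x
nth (x ∷ xs) (suc i) = nth xs i

-- q_j(k) for 1 ≤ j ≤ s_k  (index j is 1-based; out of range gives 0, never used)
q : ℕ → ℕ → ℕ
q j k = nth (bits k) (j ∸ 1)

M : ℕ → ℕ → ℕ
M i k = sum (map (2 ℕ.^_) (drop (i ∸ 1) (bits k)))

module WithRing {c ℓ : Level} (R : CommutativeRing c ℓ) where
  open CommutativeRing R

  fromℕ : ℕ → Carrier
  fromℕ zero    = 0#
  fromℕ (suc n) = 1# + fromℕ n

  pow : Carrier → ℕ → Carrier
  pow x zero    = 1#
  pow x (suc n) = x * pow x n

  sumFrom : ℕ → ℕ → (ℕ → Carrier) → Carrier
  sumFrom lo zero    f = 0#
  sumFrom lo (suc n) f = f lo + sumFrom (suc lo) n f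

  -- Σ_{j=lo}^{hi} f j   (empty if hi < lo)
  Σ[_⋯_] : ℕ → ℕ → (ℕ → Carrier) → Carrier
  Σ[ lo ⋯ hi ] f = sumFrom lo (suc hi ∸ lo) f

  -- h plays the role of 2⁻¹, so b m a = 2^{-m} a
  module Params (h a : Carrier) where
    b : ℕ → Carrier
    b m = pow h m * a

    S : ℕ → ℕ → ℕ → Carrier
    S d m n = Σ[ 1 ⋯ s n ∸ 1 ] (λ j →
      fromℕ (q j n ℕ.^ d) * pow (b m) (q j n) * fromℕ (M (suc j) n ℕ.^ m))

    α : ℕ → ℕ → ℕ → Carrier
    α d m n = Σ[ 1 ⋯ n ∸ 1 ] (λ k → S d m k)

    γ : ℕ → ℕ → ℕ → ℕ → Carrier
    γ d p m l = Σ[ 1 ⋯ 2 ℕ.^ l ∸ 1 ] (λ k → Σ[ 1 ⋯ s k ] (λ i →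
      fromℕ (q i k ℕ.^ d) * pow (b m) (q i k) * fromℕ (M (suc i) k ℕ.^ p)))

{-# OPTIONS --safe #-}
-- If 2^l divides N (that is, l ≤ q₁(N)) and k < 2^l, the binary digits of N + k are those
-- of k followed by those of N. So along the k-part of N + k every tail sum M_{i+1} is shifted
-- by exactly N, while along the N-part nothing changes. Expanding (N + M_{i+1}(k))^m by the
-- binomial theorem gives S_{N+k} = S_k + Σ_{p<m} C(m,p) N^{m-p} (Σ_i ⋯ M_{i+1}(k)^p) + S_N,
-- where the top term p = m is S_k itself, and summing over k < 2^l gives the identity.
-- The argument is purely combinatorial: it holds for every h and a.
module Submission where

open import Defs
open import Level using (Level)
open import Algebra.Bundles using (CommutativeRing)
open import Data.Fin using (toℕ)
open import Data.List using (List; []; _∷_; _++_; length; drop)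
open import Data.List.Properties using (drop-all)
open import Data.Nat as ℕ using (ℕ; zero; suc; _∸_; _≤_; _<_; z≤n; s≤s)
open import Data.Nat.Combinatorics using (_C_; nCn≡1)
import Data.Nat.Properties as ℕ
open import Relation.Binary.PropositionalEquality as ≡ using (_≡_)
open import Relation.Nullary using (¬_)

module Binary where
  open import Data.Bool using (if_then_else_)
  open import Data.List using (map)
  open import Data.List.Properties using (map-++)
  open import Data.Nat using (_+_; _*_; _^_; s≤s⁻¹)
  open import Data.Nat.DivMod
    using (_/_; _%_; m/n<m; m*n%n≡0; m*n/n≡m; [m+kn]%n≡m%n; +-distrib-/-∣ʳ)
  open import Data.Nat.Divisibility using (divides-refl)
  open import Data.Nat.Induction using (<-rec)
  open import Data.Nat.ListAction using (sum)
  open import Data.Nat.ListAction.Properties using (sum-++)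
  open import Data.Nat.Properties
  open import Data.Nat.Tactic.RingSolver using (solve-∀)
  open import Relation.Binary.PropositionalEquality
  open import Relation.Nullary using (contradiction)

  bitsFrom : ℕ → ℕ → List ℕ
  bitsFrom o n = bitsGo n n o

  bitValue : List ℕ → ℕ
  bitValue L = sum (map (2 ^_) L)

  data Parity : ℕ → Set where
    even : ∀ X → Parity (X * 2)
    odd  : ∀ X → Parity (1 + X * 2)

  parity : ∀ n → Parity n
  parity zero = even 0
  parity (suc n) with parity n
  ... | even X = odd X
  ... | odd X  = even (suc X)

  [1+n]/2≤n : ∀ n → suc n / 2 ≤ n
  [1+n]/2≤n n = s≤s⁻¹ (m/n<m (suc n) 2 (s≤s (s≤s z≤n)))

  bitsGo-fuel : ∀ f g n o → n ≤ f → n ≤ g → bitsGo f n o ≡ bitsGo g n o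
  bitsGo-fuel zero    zero    zero    o _ _ = refl
  bitsGo-fuel zero    (suc g) zero    o _ _ = refl
  bitsGo-fuel (suc f) zero    zero    o _ _ = refl
  bitsGo-fuel (suc f) (suc g) zero    o _ _ = refl
  bitsGo-fuel (suc f) (suc g) (suc n) o (s≤s n≤f) (s≤s n≤g) =
    cong (λ t → if suc n % 2 ℕ.≡ᵇ 1 then o ∷ t else t)
      (bitsGo-fuel f g (suc n / 2) (suc o)
        (≤-trans ([1+n]/2≤n n) n≤f) (≤-trans ([1+n]/2≤n n) n≤g))

  bitsFrom-suc : ∀ o n → bitsFrom o (suc n) ≡
    (if suc n % 2 ℕ.≡ᵇ 1 then o ∷ bitsFrom (suc o) (suc n / 2) else bitsFrom (suc o) (suc n / 2))
  bitsFrom-suc o n = cong (λ t → if suc n % 2 ℕ.≡ᵇ 1 then o ∷ t else t)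
    (bitsGo-fuel n (suc n / 2) (suc n / 2) (suc o) ([1+n]/2≤n n) ≤-refl)

  bitsFrom-*2 : ∀ o X → bitsFrom o (X * 2) ≡ bitsFrom (suc o) X
  bitsFrom-*2 o zero    = refl
  bitsFrom-*2 o (suc X) = trans (bitsFrom-suc o (suc (X * 2)))
    (cong₂ (λ r y → if r ℕ.≡ᵇ 1 then o ∷ bitsFrom (suc o) y else bitsFrom (suc o) y)
      (m*n%n≡0 (suc X) 2) (m*n/n≡m (suc X) 2))

  bitsFrom-1+*2 : ∀ o X → bitsFrom o (1 + X * 2) ≡ o ∷ bitsFrom (suc o) X
  bitsFrom-1+*2 o X = trans (bitsFrom-suc o (X * 2))
    (cong₂ (λ r y → if r ℕ.≡ᵇ 1 then o ∷ bitsFrom (suc o) y else bitsFrom (suc o) y)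
      ([m+kn]%n≡m%n 1 X 2) (trans (+-distrib-/-∣ʳ 1 {d = 2} (divides-refl X)) (m*n/n≡m X 2)))

  bitValue-bitsFrom : ∀ n o → bitValue (bitsFrom o n) ≡ 2 ^ o * n
  bitValue-bitsFrom = <-rec _ step
    where
    open ≡-Reasoning
    double : ∀ p X → 2 * p * X ≡ p * (X * 2)
    double = solve-∀
    double+1 : ∀ p X → p + 2 * p * X ≡ p * (1 + X * 2)
    double+1 = solve-∀
    step : ∀ n → (∀ {m} → m < n → ∀ o → bitValue (bitsFrom o m) ≡ 2 ^ o * m) →
           ∀ o → bitValue (bitsFrom o n) ≡ 2 ^ o * n
    step n rec o with parity n
    ... | even zero    = sym (*-zeroʳ (2 ^ o))
    ... | even (suc X) = begin
      bitValue (bitsFrom o (suc X * 2))     ≡⟨ cong bitValue (bitsFrom-*2 o (suc X)) ⟩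
      bitValue (bitsFrom (suc o) (suc X))   ≡⟨ rec (m<m*n (suc X) 2 (s≤s (s≤s z≤n))) (suc o) ⟩
      2 * 2 ^ o * suc X                     ≡⟨ double (2 ^ o) (suc X) ⟩
      2 ^ o * (suc X * 2)                   ∎
    ... | odd X = begin
      bitValue (bitsFrom o (1 + X * 2))     ≡⟨ cong bitValue (bitsFrom-1+*2 o X) ⟩
      2 ^ o + bitValue (bitsFrom (suc o) X) ≡⟨ cong (2 ^ o +_) (rec (s≤s (m≤m*n X 2)) (suc o)) ⟩
      2 ^ o + 2 * 2 ^ o * X                 ≡⟨ double+1 (2 ^ o) X ⟩
      2 ^ o * (1 + X * 2)                   ∎

  bitValue-bits : ∀ n → bitValue (bits n) ≡ n
  bitValue-bits n = trans (bitValue-bitsFrom n 0) (*-identityˡ n)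

  bitValue-++ : ∀ L L′ → bitValue (L ++ L′) ≡ bitValue L + bitValue L′
  bitValue-++ L L′ = trans (cong sum (map-++ (2 ^_) L L′)) (sum-++ (map (2 ^_) L) (map (2 ^_) L′))

  m*2<2^[1+n]⇒m<2^n : ∀ m n → m * 2 < 2 ^ suc n → m < 2 ^ n
  m*2<2^[1+n]⇒m<2^n m n m*2<2^[1+n] =
    *-cancelʳ-< 2 m (2 ^ n) (subst (m * 2 <_) (*-comm 2 (2 ^ n)) m*2<2^[1+n])

  lowestBit-bitsFrom-*2 : ∀ {o l} X →
    o + suc l ≤ nth (bitsFrom o (X * 2)) 0 → suc o + l ≤ nth (bitsFrom (suc o) X) 0
  lowestBit-bitsFrom-*2 {o} {l} X = subst₂ (λ i L → i ≤ nth L 0) (+-suc o l) (bitsFrom-*2 o X)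

  bitsFrom-+ : ∀ l o k N → k < 2 ^ l → o + l ≤ nth (bitsFrom o N) 0 →
               bitsFrom o (k + N) ≡ bitsFrom o k ++ bitsFrom o N
  bitsFrom-+ zero    o zero    N _          _ = refl
  bitsFrom-+ zero    o (suc k) N (s≤s ())   _
  bitsFrom-+ (suc l) o k       N k<2^[1+l] l≤q₁ with parity N
  ... | odd X =
    contradiction (subst (λ L → o + suc l ≤ nth L 0) (bitsFrom-1+*2 o X) l≤q₁) (m+1+n≰m o)
  ... | even X with parity k
  ...   | even K = begin
    bitsFrom o (K * 2 + X * 2)                ≡⟨ cong (bitsFrom o) (sym (*-distribʳ-+ 2 K X)) ⟩
    bitsFrom o ((K + X) * 2)                  ≡⟨ bitsFrom-*2 o (K + X) ⟩
    bitsFrom (suc o) (K + X)                  ≡⟨ split ⟩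
    bitsFrom (suc o) K ++ bitsFrom (suc o) X  ≡⟨ sym (cong₂ _++_ (bitsFrom-*2 o K) (bitsFrom-*2 o X)) ⟩
    bitsFrom o (K * 2) ++ bitsFrom o (X * 2)  ∎
    where
    open ≡-Reasoning
    split = bitsFrom-+ l (suc o) K X (m*2<2^[1+n]⇒m<2^n K l k<2^[1+l]) (lowestBit-bitsFrom-*2 X l≤q₁)
  ...   | odd K = begin
    bitsFrom o (1 + K * 2 + X * 2)               ≡⟨ cong (λ n → bitsFrom o (suc n)) (sym (*-distribʳ-+ 2 K X)) ⟩
    bitsFrom o (1 + (K + X) * 2)                 ≡⟨ bitsFrom-1+*2 o (K + X) ⟩
    o ∷ bitsFrom (suc o) (K + X)                 ≡⟨ cong (o ∷_) split ⟩
    o ∷ bitsFrom (suc o) K ++ bitsFrom (suc o) X ≡⟨ sym (cong₂ _++_ (bitsFrom-1+*2 o K) (bitsFrom-*2 o X)) ⟩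
    bitsFrom o (1 + K * 2) ++ bitsFrom o (X * 2) ∎
    where
    open ≡-Reasoning
    split = bitsFrom-+ l (suc o) K X (m*2<2^[1+n]⇒m<2^n K l (≤-trans (n≤1+n _) k<2^[1+l]))
                       (lowestBit-bitsFrom-*2 X l≤q₁)

  bits-+ : ∀ {l k N} → k < 2 ^ l → l ≤ q 1 N → bits (k + N) ≡ bits k ++ bits N
  bits-+ {l} {k} {N} = bitsFrom-+ l 0 k N

open Binary

module RingSums {r ℓ : Level} (R : CommutativeRing r ℓ) where
  open CommutativeRing R
  open WithRing R
  open import Algebra.Properties.Semiring.Mult semiring using (_×_; ×-homo-+; ×1-homo-*)
  open import Algebra.Properties.Semiring.Sum semiring using (sum; sum-cong-≋)
  open import Algebra.Properties.Semiring.Exp semiring using (_^_)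
  import Algebra.Properties.Semiring.Binomial semiring as Binomial
  import Algebra.Properties.CommutativeSemigroup *-commutativeSemigroup as *
  import Algebra.Properties.CommutativeSemigroup +-commutativeSemigroup as +
  open import Relation.Binary.Reasoning.Setoid setoid

  sumFrom-congOn : ∀ lo n {f g : ℕ → Carrier} →
    (∀ j → lo ≤ j → j < lo ℕ.+ n → f j ≈ g j) → sumFrom lo n f ≈ sumFrom lo n g
  sumFrom-congOn lo zero    f≈g = refl
  sumFrom-congOn lo (suc n) f≈g = +-cong (f≈g lo ℕ.≤-refl (ℕ.m<m+n lo (s≤s z≤n)))
    (sumFrom-congOn (suc lo) n λ j lo<j j<lo+1+n →
      f≈g j (ℕ.<⇒≤ lo<j) (≡.subst (j <_) (≡.sym (ℕ.+-suc lo n)) j<lo+1+n))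

  sumFrom-cong : ∀ lo n {f g : ℕ → Carrier} → (∀ j → f j ≈ g j) → sumFrom lo n f ≈ sumFrom lo n g
  sumFrom-cong lo n f≈g = sumFrom-congOn lo n (λ j _ _ → f≈g j)

  sumFrom-suc : ∀ lo n f → sumFrom (suc lo) n f ≡ sumFrom lo n (λ j → f (suc j))
  sumFrom-suc lo zero    f = ≡.refl
  sumFrom-suc lo (suc n) f = ≡.cong (f (suc lo) +_) (sumFrom-suc (suc lo) n f)

  sumFrom-shift : ∀ lo n f → sumFrom lo n f ≡ sumFrom 0 n (λ j → f (lo ℕ.+ j))
  sumFrom-shift zero     n f = ≡.refl
  sumFrom-shift (suc lo) n f = ≡.trans (sumFrom-suc lo n f) (sumFrom-shift lo n (λ j → f (suc j)))

  sumFrom-split : ∀ lo a b f → sumFrom lo (a ℕ.+ b) f ≈ sumFrom lo a f + sumFrom (lo ℕ.+ a) b f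
  sumFrom-split lo zero    b f =
    trans (reflexive (≡.cong (λ i → sumFrom i b f) (≡.sym (ℕ.+-identityʳ lo)))) (sym (+-identityˡ _))
  sumFrom-split lo (suc a) b f = begin
    f lo + sumFrom (suc lo) (a ℕ.+ b) f                        ≈⟨ +-congˡ (sumFrom-split (suc lo) a b f) ⟩
    f lo + (sumFrom (suc lo) a f + sumFrom (suc lo ℕ.+ a) b f) ≈⟨ +-assoc _ _ _ ⟨
    f lo + sumFrom (suc lo) a f + sumFrom (suc lo ℕ.+ a) b f
      ≡⟨ ≡.cong (λ i → f lo + sumFrom (suc lo) a f + sumFrom i b f) (ℕ.+-suc lo a) ⟨
    f lo + sumFrom (suc lo) a f + sumFrom (lo ℕ.+ suc a) b f   ∎

  sumFrom-last : ∀ lo n f → sumFrom lo (suc n) f ≈ sumFrom lo n f + f (lo ℕ.+ n)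
  sumFrom-last lo n f = begin
    sumFrom lo (suc n) f                 ≡⟨ ≡.cong (λ k → sumFrom lo k f) (ℕ.+-comm 1 n) ⟩
    sumFrom lo (n ℕ.+ 1) f               ≈⟨ sumFrom-split lo n 1 f ⟩
    sumFrom lo n f + (f (lo ℕ.+ n) + 0#) ≈⟨ +-congˡ (+-identityʳ _) ⟩
    sumFrom lo n f + f (lo ℕ.+ n)        ∎

  sumFrom-drop-zero : ∀ n {f} → f 0 ≈ 0# → sumFrom 0 n f ≈ sumFrom 1 (n ∸ 1) f
  sumFrom-drop-zero zero    f0≈0 = refl
  sumFrom-drop-zero (suc n) f0≈0 = trans (+-congʳ f0≈0) (+-identityˡ _)

  sumFrom-+ : ∀ lo n f g → sumFrom lo n (λ j → f j + g j) ≈ sumFrom lo n f + sumFrom lo n g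
  sumFrom-+ lo zero    f g = sym (+-identityˡ 0#)
  sumFrom-+ lo (suc n) f g = trans (+-congˡ (sumFrom-+ (suc lo) n f g)) (+.interchange _ _ _ _)

  sumFrom-*ˡ : ∀ x lo n f → x * sumFrom lo n f ≈ sumFrom lo n (λ j → x * f j)
  sumFrom-*ˡ x lo zero    f = zeroʳ x
  sumFrom-*ˡ x lo (suc n) f = trans (distribˡ x _ _) (+-congˡ (sumFrom-*ˡ x (suc lo) n f))

  sumFrom-const : ∀ lo n x → sumFrom lo n (λ _ → x) ≈ fromℕ n * x
  sumFrom-const lo zero    x = sym (zeroˡ x)
  sumFrom-const lo (suc n) x = begin
    x + sumFrom (suc lo) n (λ _ → x) ≈⟨ +-cong (sym (*-identityˡ x)) (sumFrom-const (suc lo) n x) ⟩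
    1# * x + fromℕ n * x             ≈⟨ distribʳ x 1# (fromℕ n) ⟨
    (1# + fromℕ n) * x               ∎

  sumFrom-swap : ∀ lo n lo′ n′ (F : ℕ → ℕ → Carrier) →
    sumFrom lo n (λ i → sumFrom lo′ n′ (F i)) ≈ sumFrom lo′ n′ (λ j → sumFrom lo n (λ i → F i j))
  sumFrom-swap lo zero    lo′ n′ F = sym (trans (sumFrom-const lo′ n′ 0#) (zeroʳ _))
  sumFrom-swap lo (suc n) lo′ n′ F =
    trans (+-congˡ (sumFrom-swap (suc lo) n lo′ n′ F)) (sym (sumFrom-+ lo′ n′ (F lo) _))

  fromℕ≡×1 : ∀ n → fromℕ n ≡ n × 1#
  fromℕ≡×1 zero    = ≡.refl
  fromℕ≡×1 (suc n) = ≡.cong (1# +_) (fromℕ≡×1 n)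

  fromℕ-+ : ∀ m n → fromℕ (m ℕ.+ n) ≈ fromℕ m + fromℕ n
  fromℕ-+ m n rewrite fromℕ≡×1 (m ℕ.+ n) | fromℕ≡×1 m | fromℕ≡×1 n = ×-homo-+ 1# m n

  fromℕ-* : ∀ m n → fromℕ (m ℕ.* n) ≈ fromℕ m * fromℕ n
  fromℕ-* m n rewrite fromℕ≡×1 (m ℕ.* n) | fromℕ≡×1 m | fromℕ≡×1 n = ×1-homo-* m n

  fromℕ-^ : ∀ m n → fromℕ (m ℕ.^ n) ≈ pow (fromℕ m) n
  fromℕ-^ m zero    = +-identityʳ 1#
  fromℕ-^ m (suc n) = trans (fromℕ-* m (m ℕ.^ n)) (*-congˡ (fromℕ-^ m n))

  ×≈fromℕ* : ∀ n x → n × x ≈ fromℕ n * x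
  ×≈fromℕ* zero    x = sym (zeroˡ x)
  ×≈fromℕ* (suc n) x =
    trans (+-cong (sym (*-identityˡ x)) (×≈fromℕ* n x)) (sym (distribʳ x 1# (fromℕ n)))

  pow≡^ : ∀ x n → pow x n ≡ x ^ n
  pow≡^ x zero    = ≡.refl
  pow≡^ x (suc n) = ≡.cong (x *_) (pow≡^ x n)

  pow-congˡ : ∀ {x y} n → x ≈ y → pow x n ≈ pow y n
  pow-congˡ zero    x≈y = refl
  pow-congˡ (suc n) x≈y = *-cong x≈y (pow-congˡ n x≈y)

  sum≡sumFrom : ∀ n (f : ℕ → Carrier) → sum {n} (λ i → f (toℕ i)) ≡ sumFrom 0 n f
  sum≡sumFrom zero    f = ≡.refl
  sum≡sumFrom (suc n) f =
    ≡.cong (f 0 +_) (≡.trans (sum≡sumFrom n (λ j → f (suc j))) (≡.sym (sumFrom-suc 0 n f)))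

  binomial : ∀ x y m →
    pow (x + y) m ≈ sumFrom 0 (suc m) (λ p → fromℕ (m C p) * pow y (m ∸ p) * pow x p)
  binomial x y m = begin
    pow (x + y) m                             ≡⟨ pow≡^ (x + y) m ⟩
    (x + y) ^ m                               ≈⟨ Binomial.theorem x y (*-comm x y) m ⟩
    sum {suc m} (Binomial.binomialTerm x y m) ≈⟨ sum-cong-≋ {suc m} (λ i → term (toℕ i)) ⟩
    sum {suc m} (λ i → t (toℕ i))             ≡⟨ sum≡sumFrom (suc m) t ⟩
    sumFrom 0 (suc m) t                       ∎
    where
    t : ℕ → Carrier
    t p = fromℕ (m C p) * pow y (m ∸ p) * pow x p
    term : ∀ p → (m C p) × (x ^ p * y ^ (m ∸ p)) ≈ t p
    term p = begin
      (m C p) × (x ^ p * y ^ (m ∸ p))       ≈⟨ ×≈fromℕ* (m C p) _ ⟩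
      fromℕ (m C p) * (x ^ p * y ^ (m ∸ p)) ≈⟨ *-congˡ (*-comm _ _) ⟩
      fromℕ (m C p) * (y ^ (m ∸ p) * x ^ p) ≈⟨ *-assoc _ _ _ ⟨
      fromℕ (m C p) * y ^ (m ∸ p) * x ^ p
        ≡⟨ ≡.cong₂ (λ u v → fromℕ (m C p) * u * v) (pow≡^ y (m ∸ p)) (pow≡^ x p) ⟨
      t p                                   ∎

  fromℕ-binomial : ∀ E Y m → fromℕ ((E ℕ.+ Y) ℕ.^ m)
    ≈ sumFrom 0 (suc m) (λ p → fromℕ (m C p) * fromℕ (E ℕ.^ (m ∸ p)) * fromℕ (Y ℕ.^ p))
  fromℕ-binomial E Y m = begin
    fromℕ ((E ℕ.+ Y) ℕ.^ m)   ≡⟨ ≡.cong (λ n → fromℕ (n ℕ.^ m)) (ℕ.+-comm E Y) ⟩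
    fromℕ ((Y ℕ.+ E) ℕ.^ m)   ≈⟨ fromℕ-^ (Y ℕ.+ E) m ⟩
    pow (fromℕ (Y ℕ.+ E)) m   ≈⟨ pow-congˡ m (fromℕ-+ Y E) ⟩
    pow (fromℕ Y + fromℕ E) m ≈⟨ binomial (fromℕ Y) (fromℕ E) m ⟩
    sumFrom 0 (suc m) (λ p → fromℕ (m C p) * pow (fromℕ E) (m ∸ p) * pow (fromℕ Y) p)
      ≈⟨ sumFrom-cong 0 (suc m) (λ p → *-cong (*-congˡ (sym (fromℕ-^ E (m ∸ p)))) (sym (fromℕ-^ Y p))) ⟩
    sumFrom 0 (suc m) (λ p → fromℕ (m C p) * fromℕ (E ℕ.^ (m ∸ p)) * fromℕ (Y ℕ.^ p)) ∎

  -- The summand of S and of the inner sums of γ, with weight G(q_j) and power p of M_{j+1}.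
  tailPowerTerm : (ℕ → Carrier) → ℕ → List ℕ → ℕ → Carrier
  tailPowerTerm G p L j = G (nth L (j ∸ 1)) * fromℕ (bitValue (drop j L) ℕ.^ p)

  -- E is the value of further (higher) digits following L.
  tailPowerSum : (ℕ → Carrier) → ℕ → ℕ → List ℕ → Carrier
  tailPowerSum G p E []       = 0#
  tailPowerSum G p E (x ∷ xs) = G x * fromℕ ((E ℕ.+ bitValue xs) ℕ.^ p) + tailPowerSum G p E xs

  sumFrom-tailPowerTerm : ∀ G p L → sumFrom 1 (length L) (tailPowerTerm G p L) ≡ tailPowerSum G p 0 L
  sumFrom-tailPowerTerm G p []       = ≡.refl
  sumFrom-tailPowerTerm G p (x ∷ xs) = ≡.cong (G x * fromℕ (bitValue xs ℕ.^ p) +_)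
    (≡.trans (sumFrom-shift 2 (length xs) _)
    (≡.trans (≡.sym (sumFrom-shift 1 (length xs) _)) (sumFrom-tailPowerTerm G p xs)))

  -- The omitted last term carries the factor 0 ^ suc p.
  sumFrom-tailPowerTerm-init : ∀ G p L →
    sumFrom 1 (length L ∸ 1) (tailPowerTerm G (suc p) L) ≈ tailPowerSum G (suc p) 0 L
  sumFrom-tailPowerTerm-init G p []       = refl
  sumFrom-tailPowerTerm-init G p (x ∷ xs) = begin
    sumFrom 1 (length xs) f                       ≈⟨ +-identityʳ _ ⟨
    sumFrom 1 (length xs) f + 0#                  ≈⟨ +-congˡ last≈0 ⟨
    sumFrom 1 (length xs) f + f (suc (length xs)) ≈⟨ sumFrom-last 1 (length xs) f ⟨
    sumFrom 1 (length (x ∷ xs)) f                 ≡⟨ sumFrom-tailPowerTerm G (suc p) (x ∷ xs) ⟩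
    tailPowerSum G (suc p) 0 (x ∷ xs)             ∎
    where
    f : ℕ → Carrier
    f = tailPowerTerm G (suc p) (x ∷ xs)
    last≈0 : f (suc (length xs)) ≈ 0#
    last≈0 = trans (*-congˡ (reflexive (≡.cong (λ L → fromℕ (bitValue L ℕ.^ suc p))
                                                (drop-all (length xs) xs ℕ.≤-refl))))
                   (zeroʳ _)

  tailPowerSum-++ : ∀ G p E L L′ →
    tailPowerSum G p E (L ++ L′) ≈ tailPowerSum G p (E ℕ.+ bitValue L′) L + tailPowerSum G p E L′
  tailPowerSum-++ G p E []       L′ = sym (+-identityˡ _)
  tailPowerSum-++ G p E (x ∷ xs) L′ = begin
    G x * fromℕ ((E ℕ.+ bitValue (xs ++ L′)) ℕ.^ p) + T E (xs ++ L′)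
      ≈⟨ +-cong (reflexive (≡.cong (λ n → G x * fromℕ (n ℕ.^ p)) reassoc)) (tailPowerSum-++ G p E xs L′) ⟩
    G x * fromℕ ((E′ ℕ.+ bitValue xs) ℕ.^ p) + (T E′ xs + T E L′)
      ≈⟨ +-assoc _ _ _ ⟨
    T E′ (x ∷ xs) + T E L′ ∎
    where
    T : ℕ → List ℕ → Carrier
    T = tailPowerSum G p
    E′ : ℕ
    E′ = E ℕ.+ bitValue L′
    reassoc : E ℕ.+ bitValue (xs ++ L′) ≡ E′ ℕ.+ bitValue xs
    reassoc = ≡.trans (≡.cong (E ℕ.+_) (≡.trans (bitValue-++ xs L′) (ℕ.+-comm (bitValue xs) _)))
                      (≡.sym (ℕ.+-assoc E _ _))

  tailPowerSum-binomial : ∀ G m E L → tailPowerSum G m E L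
    ≈ sumFrom 0 (suc m) (λ p → fromℕ (m C p) * fromℕ (E ℕ.^ (m ∸ p)) * tailPowerSum G p 0 L)
  tailPowerSum-binomial G m E []       =
    sym (trans (sumFrom-cong 0 (suc m) (λ p → zeroʳ _)) (trans (sumFrom-const 0 (suc m) 0#) (zeroʳ _)))
  tailPowerSum-binomial G m E (x ∷ xs) = begin
    G x * fromℕ ((E ℕ.+ Y) ℕ.^ m) + tailPowerSum G m E xs
      ≈⟨ +-cong (*-congˡ (fromℕ-binomial E Y m)) (tailPowerSum-binomial G m E xs) ⟩
    G x * Σ (λ p → coeff p * fromℕ (Y ℕ.^ p)) + Σ (λ p → coeff p * T p xs)
      ≈⟨ +-congʳ (sumFrom-*ˡ (G x) 0 (suc m) _) ⟩
    Σ (λ p → G x * (coeff p * fromℕ (Y ℕ.^ p))) + Σ (λ p → coeff p * T p xs)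
      ≈⟨ sumFrom-+ 0 (suc m) _ _ ⟨
    Σ (λ p → G x * (coeff p * fromℕ (Y ℕ.^ p)) + coeff p * T p xs)
      ≈⟨ sumFrom-cong 0 (suc m) (λ p → trans (+-congʳ (*.x∙yz≈y∙xz _ _ _)) (sym (distribˡ _ _ _))) ⟩
    Σ (λ p → coeff p * T p (x ∷ xs)) ∎
    where
    Y : ℕ
    Y = bitValue xs
    Σ : (ℕ → Carrier) → Carrier
    Σ = sumFrom 0 (suc m)
    T : ℕ → List ℕ → Carrier
    T p = tailPowerSum G p 0
    coeff : ℕ → Carrier
    coeff p = fromℕ (m C p) * fromℕ (E ℕ.^ (m ∸ p))

  module _ (h a : Carrier) where
    open Params h a

    weight : ℕ → ℕ → ℕ → Carrier
    weight d m x = fromℕ (x ℕ.^ d) * pow (b m) x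

    S-tailPowerSum : ∀ d m n → S d (suc m) n ≈ tailPowerSum (weight d (suc m)) (suc m) 0 (bits n)
    S-tailPowerSum d m n = sumFrom-tailPowerTerm-init (weight d (suc m)) m (bits n)

    γ-tailPowerSum : ∀ d p m l →
      γ d p m l ≈ sumFrom 1 (2 ℕ.^ l ∸ 1) (λ k → tailPowerSum (weight d m) p 0 (bits k))
    γ-tailPowerSum d p m l =
      sumFrom-cong 1 (2 ℕ.^ l ∸ 1) (λ k → reflexive (sumFrom-tailPowerTerm (weight d m) p (bits k)))

    S-+ : ∀ d m N l k → k < 2 ℕ.^ l → l ≤ q 1 N →
      S d (suc m) (N ℕ.+ k)
        ≈ S d (suc m) k
          + sumFrom 0 (suc m) (λ p → fromℕ (suc m C p) * fromℕ (N ℕ.^ (suc m ∸ p))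
                                       * tailPowerSum (weight d (suc m)) p 0 (bits k))
          + S d (suc m) N
    S-+ d m N l k k<2^l l≤q₁ = begin
      S d m′ (N ℕ.+ k)                                    ≈⟨ S-tailPowerSum d m (N ℕ.+ k) ⟩
      T m′ 0 (bits (N ℕ.+ k))                             ≡⟨ ≡.cong (T m′ 0) digits ⟩
      T m′ 0 (bits k ++ bits N)                           ≈⟨ tailPowerSum-++ G m′ 0 (bits k) (bits N) ⟩
      T m′ (bitValue (bits N)) (bits k) + T m′ 0 (bits N)
        ≡⟨ ≡.cong (λ E → T m′ E (bits k) + T m′ 0 (bits N)) (bitValue-bits N) ⟩
      T m′ N (bits k) + T m′ 0 (bits N)
        ≈⟨ +-cong (tailPowerSum-binomial G m′ N (bits k)) (sym (S-tailPowerSum d m N)) ⟩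
      sumFrom 0 (suc m′) (λ p → c p * T p 0 (bits k)) + S d m′ N
        ≈⟨ +-congʳ (sumFrom-last 0 m′ _) ⟩
      sumFrom 0 m′ (λ p → c p * T p 0 (bits k)) + c m′ * T m′ 0 (bits k) + S d m′ N
        ≈⟨ +-congʳ (trans (+-congˡ top) (+-comm _ _)) ⟩
      S d m′ k + sumFrom 0 m′ (λ p → c p * T p 0 (bits k)) + S d m′ N ∎
      where
      m′ : ℕ
      m′ = suc m
      G : ℕ → Carrier
      G = weight d m′
      T : ℕ → ℕ → List ℕ → Carrier
      T = tailPowerSum G
      c : ℕ → Carrier
      c p = fromℕ (m′ C p) * fromℕ (N ℕ.^ (m′ ∸ p))
      digits : bits (N ℕ.+ k) ≡ bits k ++ bits N
      digits = ≡.trans (≡.cong bits (ℕ.+-comm N k)) (bits-+ k<2^l l≤q₁)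
      top : c m′ * T m′ 0 (bits k) ≈ S d m′ k
      top = begin
        fromℕ (m′ C m′) * fromℕ (N ℕ.^ (m′ ∸ m′)) * T m′ 0 (bits k)
          ≡⟨ ≡.cong₂ (λ i j → fromℕ i * fromℕ (N ℕ.^ j) * T m′ 0 (bits k)) (nCn≡1 m′) (ℕ.n∸n≡0 m′) ⟩
        (1# + 0#) * (1# + 0#) * T m′ 0 (bits k)
          ≈⟨ *-congʳ (trans (*-cong (+-identityʳ 1#) (+-identityʳ 1#)) (*-identityˡ 1#)) ⟩
        1# * T m′ 0 (bits k) ≈⟨ *-identityˡ _ ⟩
        T m′ 0 (bits k)      ≈⟨ S-tailPowerSum d m k ⟨
        S d m′ k             ∎

    sumFrom-tailPowerSums : ∀ d m l (c : ℕ → Carrier) →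
      sumFrom 0 (2 ℕ.^ l) (λ k → sumFrom 0 m (λ p → c p * tailPowerSum (weight d m) p 0 (bits k)))
        ≈ sumFrom 0 m (λ p → c p * γ d p m l)
    sumFrom-tailPowerSums d m l c = begin
      sumFrom 0 L (λ k → sumFrom 0 m (λ p → c p * T p (bits k)))
        ≈⟨ sumFrom-swap 0 L 0 m _ ⟩
      sumFrom 0 m (λ p → sumFrom 0 L (λ k → c p * T p (bits k)))
        ≈⟨ sumFrom-cong 0 m (λ p → sym (sumFrom-*ˡ (c p) 0 L _)) ⟩
      sumFrom 0 m (λ p → c p * sumFrom 0 L (λ k → T p (bits k)))
        ≈⟨ sumFrom-cong 0 m (λ p → *-congˡ (sumFrom-drop-zero L refl)) ⟩
      sumFrom 0 m (λ p → c p * sumFrom 1 (L ∸ 1) (λ k → T p (bits k)))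
        ≈⟨ sumFrom-cong 0 m (λ p → *-congˡ (sym (γ-tailPowerSum d p m l))) ⟩
      sumFrom 0 m (λ p → c p * γ d p m l) ∎
      where
      L : ℕ
      L = 2 ℕ.^ l
      T : ℕ → List ℕ → Carrier
      T p = tailPowerSum (weight d m) p 0

lemma6 : ∀ {c ℓ : Level} (R : CommutativeRing c ℓ) →
    let open CommutativeRing R in
    let open WithRing R in
    (h a : Carrier) → h * (1# + 1#) ≈ 1# → ¬ (a ≈ 0#) →
    (m d N l : ℕ) → 1 ≤ m → 1 ≤ N → l ≤ q 1 N →
    let open Params h a in
    α d m (N ℕ.+ 2 ℕ.^ l)
      ≈ α d m N + α d m (2 ℕ.^ l)
        + Σ[ 0 ⋯ m ∸ 1 ] (λ p → fromℕ (m C p) * fromℕ (N ℕ.^ (m ∸ p)) * γ d p m l)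
        + fromℕ (2 ℕ.^ l) * S d m N
lemma6 R h a _ _ m@(suc m-1) d N@(suc N-1) l (s≤s z≤n) (s≤s z≤n) l≤q₁ = begin
  sumFrom 1 (N-1 ℕ.+ L) (S d m)                       ≈⟨ sumFrom-split 1 N-1 L (S d m) ⟩
  α d m N + sumFrom N L (S d m)                       ≡⟨ ≡.cong (α d m N +_) (sumFrom-shift N L (S d m)) ⟩
  α d m N + sumFrom 0 L (λ k → S d m (N ℕ.+ k))
    ≈⟨ +-congˡ (sumFrom-congOn 0 L (λ k _ k<L → S-+ h a d m-1 N l k k<L l≤q₁)) ⟩
  α d m N + sumFrom 0 L (λ k → S d m k + P k + S d m N)
    ≈⟨ +-congˡ (trans (sumFrom-+ 0 L _ _) (+-cong (sumFrom-+ 0 L _ _) (sumFrom-const 0 L _))) ⟩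
  α d m N + (sumFrom 0 L (S d m) + sumFrom 0 L P + fromℕ L * S d m N)
    ≈⟨ +-congˡ (+-congʳ (+-cong (sumFrom-drop-zero L refl) (sumFrom-tailPowerSums h a d m l c))) ⟩
  α d m N + (α d m L + Σc + fromℕ L * S d m N)
    ≈⟨ trans (sym (+-assoc _ _ _)) (+-congʳ (sym (+-assoc _ _ _))) ⟩
  α d m N + α d m L + Σc + fromℕ L * S d m N          ∎
  where
  open CommutativeRing R
  open WithRing R
  open Params h a
  open RingSums R
  open import Relation.Binary.Reasoning.Setoid setoid
  L : ℕ
  L = 2 ℕ.^ l
  c : ℕ → Carrier
  c p = fromℕ (m C p) * fromℕ (N ℕ.^ (m ∸ p))
  P : ℕ → Carrier
  P k = sumFrom 0 m (λ p → c p * tailPowerSum (weight h a d m) p 0 (bits k))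
  Σc : Carrier
  Σc = sumFrom 0 m (λ p → c p * γ d p m l)
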